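{- Fix an integer $0\leq a\leq b-1$ and an integer $N\ge1$ with $N\geq \max\{ N_{a,A}, N_{b-a,b-A}\}$. For every integer $n$ with $0 \leq n\leq Nb$, $n\equiv a \pmod b$ and $n\notin \mathcal E(A)\cup (Nb- \mathcal E(b-A))$, we have $n\in NA$, except possibly when $n=n_{a,A}+jb$ for an integer $j$ satisfying $$N-N_{a,A}<j<N_{b-a,b-A}-\frac 1b\big( n_{a,A}+n_{b-a,b-A}\big).$$
   Context: $A$ is a finite set of integers with smallest element $0$, largest element $b\ge1$, and gcd of its elements equal to $1$. $\mathbb N=\{0,1,2,\dots\}$. For an integer $N\ge1$, $NA=\{a_1+\cdots+a_N:a_i\in A\}$ (repetitions allowed), and $0A=\{0\}$. For a finite set $X$ of nonnegative integers, $\mathcal P(X)=\{\sum_{x\in X} n_x x: n_x\in\mathbb N\}$ and $\mathcal E(X)=\mathbb N\setminus\mathcal P(X)$. $b-A=\{b-x:x\in A\}$; $m-Y=\{m-y:y\in Y\}$. For an integer $c$, $n_{c,A}=\min\{n\ge 0: n\equiv c\pmod b,\ n\in\mathcal P(A)\}$ and $N_{c,A}=\min\{N\ge0: n_{c,A}\in NA\}$; $n_{c,b-A}$, $N_{c,b-A}$ are defined likewise with $b-A$ in place of $A$ (same modulus $b$). -}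

module Defs where

open import Data.Nat as ℕ using (ℕ; zero; suc; _∸_; _≤_)
open import Data.Nat.GCD using (gcd)
open import Data.Integer as ℤ using (ℤ; +_)
open import Data.Integer.Divisibility using (_∣_)
open import Data.List using (List; []; _∷_; foldr; map)
open import Data.List.Membership.Propositional using (_∈_)
open import Data.List.Relation.Unary.All using (All)
open import Data.Vec as Vec using (Vec)
import Data.Vec.Relation.Unary.All as VAll
open import Data.Product using (Σ; ∃; _×_)
open import Relation.Binary.PropositionalEquality using (_≡_)
open import Relation.Nullary using (¬_)

-- A finite set A of integers with min 0, max b ≥ 1, gcd 1.
-- Since min A = 0, all elements are natural numbers; A is given as a list
-- (duplicates/order are irrelevant for every notion below).
record IsBasis (A : List ℕ) (b : ℕ) : Set where
  field
    b≥1     : 1 ≤ b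
    zero∈A  : 0 ∈ A
    b∈A     : b ∈ A
    bounded : All (_≤ b) A
    gcd≡1   : foldr gcd 0 A ≡ 1

_≡_[mod_] : ℤ → ℤ → ℕ → Set
x ≡ y [mod m ] = (+ m) ∣ (x ℤ.- y)

data InP : List ℕ → ℕ → Set where
  P-nil  : InP [] 0
  P-cons : ∀ {x xs m} (k : ℕ) → InP xs m → InP (x ∷ xs) (k ℕ.* x ℕ.+ m)

InE : List ℕ → ℕ → Set
InE X n = ¬ InP X n

InNA : ℕ → List ℕ → ℕ → Set
InNA N A n = Σ (Vec ℕ N) λ v → VAll.All (_∈ A) v × Vec.sum v ≡ n

_minus_ : ℕ → List ℕ → List ℕ
b minus A = map (b ∸_) A

InReflect : ℕ → (ℕ → Set) → ℤ → Set
InReflect m Y n = ∃ λ y → Y y × n ≡ (+ m) ℤ.- (+ y)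

IsLeast : (ℕ → Set) → ℕ → Set
IsLeast P m = P m × (∀ k → P k → m ≤ k)

Is-n : ℕ → List ℕ → ℤ → ℕ → Set
Is-n b X c = IsLeast (λ n → ((+ n) ≡ c [mod b ]) × InP X n)

Is-N : List ℕ → ℕ → ℕ → Set
Is-N X nc = IsLeast (λ N → InNA N X nc)

-- Write n = n_{a,A} + j b and N b − n = n_{b−a,b−A} + k b; the hypotheses n ∉ ℰ(A) and
-- N b − n ∉ ℰ(b − A) make j, k natural numbers.  If j + N_{a,A} ≤ N, padding a
-- representation of n_{a,A} in N_{a,A}·A with j copies of b and then with zeros puts n in N A.
-- If k + N_{b−a,b−A} ≤ N, the same padding puts N b − n in N(b − A), and replacing each
-- summand x by b − x puts n in N A.  Otherwise both inequalities fail, and since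
-- N b = n_{a,A} + n_{b−a,b−A} + (j + k) b the failure for k is the stated upper bound on j.
module Submission where

open import Defs
open import Data.Nat as ℕ using (ℕ; _≤_; _<_; suc; _∸_)
open import Data.Integer as ℤ using (ℤ; +_)
open import Data.List using (List)
open import Data.List.Membership.Propositional using (_∈_)
open import Data.List.Membership.Propositional.Properties using (∈-map⁺; ∈-map⁻)
import Data.List.Relation.Unary.All as All
open import Data.Vec as Vec using (Vec; []; _∷_)
import Data.Vec.Relation.Unary.All as VAll
open import Data.Product using (∃; Σ; _×_; _,_)
open import Data.Sum as Sum using (_⊎_; inj₁; inj₂)
open import Relation.Binary.PropositionalEquality
  using (_≡_; refl; sym; trans; cong; cong₂; subst; subst₂; module ≡-Reasoning)
open import Relation.Nullary using (¬_; yes; no; contradiction)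
import Data.Nat.Properties as ℕP
open import Algebra.Properties.CommutativeSemigroup ℕP.+-commutativeSemigroup using (interchange)
import Data.Integer.Properties as ℤP
import Data.Nat.Divisibility as ℕD
import Data.Integer.Divisibility.Signed as ℤD
import Data.Nat.Tactic.RingSolver as ℕSolver
import Data.Integer.Tactic.RingSolver as ℤSolver

InNA-∷ : ∀ {M X m x} → x ∈ X → InNA M X m → InNA (suc M) X (x ℕ.+ m)
InNA-∷ {x = x} x∈X (v , v⊆X , Σv≡m) = x ∷ v , x∈X VAll.∷ v⊆X , cong (x ℕ.+_) Σv≡m

InNA-+* : ∀ {M X m x} k → x ∈ X → InNA M X m → InNA (k ℕ.+ M) X (k ℕ.* x ℕ.+ m)
InNA-+* ℕ.zero x∈X m∈MX = m∈MX
InNA-+* {M} {X} {m} {x} (suc k) x∈X m∈MX =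
  subst (InNA (suc (k ℕ.+ M)) X) (sym (ℕP.+-assoc x (k ℕ.* x) m))
    (InNA-∷ x∈X (InNA-+* k x∈X m∈MX))

InNA-progression : ∀ {X M N m x} j → 0 ∈ X → x ∈ X → InNA M X m → j ℕ.+ M ≤ N →
  InNA N X (m ℕ.+ j ℕ.* x)
InNA-progression {X} {M} {N} {m} {x} j 0∈X x∈X m∈MX j+M≤N =
  subst₂ (λ L y → InNA L X y) (ℕP.m∸n+n≡m j+M≤N) padded≡
    (InNA-+* (N ∸ (j ℕ.+ M)) 0∈X (InNA-+* j x∈X m∈MX))
  where
  padded≡ : (N ∸ (j ℕ.+ M)) ℕ.* 0 ℕ.+ (j ℕ.* x ℕ.+ m) ≡ m ℕ.+ j ℕ.* x
  padded≡ = trans (cong (ℕ._+ (j ℕ.* x ℕ.+ m)) (ℕP.*-zeroʳ (N ∸ (j ℕ.+ M))))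
                  (ℕP.+-comm (j ℕ.* x) m)

0∈minus : ∀ {A b} → b ∈ A → 0 ∈ b minus A
0∈minus {A} {b} b∈A = subst (_∈ b minus A) (ℕP.n∸n≡0 b) (∈-map⁺ (b ∸_) b∈A)

b∈minus : ∀ {A b} → 0 ∈ A → b ∈ b minus A
b∈minus = ∈-map⁺ _

complement-sum : ∀ {A b N} → All.All (_≤ b) A →
  (v : Vec ℕ N) → VAll.All (_∈ b minus A) v →
  Σ (Vec ℕ N) λ w → VAll.All (_∈ A) w × Vec.sum w ℕ.+ Vec.sum v ≡ N ℕ.* b
complement-sum A≤b [] VAll.[] = [] , VAll.[] , refl
complement-sum {A} {b} {suc N} A≤b (y ∷ v) (y∈ VAll.∷ v⊆)
  with ∈-map⁻ (b ∸_) y∈ | complement-sum A≤b v v⊆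
... | x , x∈A , refl | w , w⊆A , Σw+Σv≡ = x ∷ w , x∈A VAll.∷ w⊆A , (begin
  (x ℕ.+ Vec.sum w) ℕ.+ ((b ∸ x) ℕ.+ Vec.sum v)
    ≡⟨ interchange x (Vec.sum w) (b ∸ x) (Vec.sum v) ⟩
  (x ℕ.+ (b ∸ x)) ℕ.+ (Vec.sum w ℕ.+ Vec.sum v)
    ≡⟨ cong₂ ℕ._+_ (ℕP.m+[n∸m]≡n (All.lookup A≤b x∈A)) Σw+Σv≡ ⟩
  b ℕ.+ N ℕ.* b
    ∎)
  where open ≡-Reasoning

InNA-minus : ∀ {A b N m} → All.All (_≤ b) A →
  InNA N (b minus A) m → InNA N A (N ℕ.* b ∸ m)
InNA-minus {N = N} A≤b (v , v⊆ , refl) with complement-sum A≤b v v⊆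
... | w , w⊆A , Σw+Σv≡ =
  w , w⊆A , trans (sym (ℕP.m+n∸n≡m (Vec.sum w) (Vec.sum v))) (cong (_∸ Vec.sum v) Σw+Σv≡)

IsLeast-≤ : ∀ {P m k} → IsLeast P m → ¬ ¬ P k → m ≤ k
IsLeast-≤ {m = m} {k} (_ , least) ¬¬Pk with m ℕP.≤? k
... | yes m≤k = m≤k
... | no m≰k = contradiction (λ Pk → m≰k (least k Pk)) ¬¬Pk

pos-∸ : ∀ {x y} → y ≤ x → + x ℤ.- + y ≡ + (x ∸ y)
pos-∸ {x} {y} y≤x = trans (ℤP.m-n≡m⊖n x y) (ℤP.⊖-≥ y≤x)

pos-+* : ∀ m j b → + (m ℕ.+ j ℕ.* b) ≡ + m ℤ.+ + j ℤ.* + b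
pos-+* m j b = trans (ℤP.pos-+ m (j ℕ.* b)) (cong (ℤ._+_ (+ m)) (ℤP.pos-* j b))

≡[mod]⇒∣∸ : ∀ {b x y c} → (+ x) ≡ c [mod b ] → (+ y) ≡ c [mod b ] → y ≤ x →
  b ℕD.∣ x ∸ y
≡[mod]⇒∣∸ {b} {x} {y} {c} x≡c y≡c y≤x =
  ℤD.∣⇒∣ᵤ (subst (ℤD._∣_ (+ b)) (trans (difference≡ (+ x) (+ y) c) (pos-∸ y≤x))
    (ℤD.∣m∣n⇒∣m-n (ℤD.∣ᵤ⇒∣ {i = + x ℤ.- c} x≡c) (ℤD.∣ᵤ⇒∣ {i = + y ℤ.- c} y≡c)))
  where
  difference≡ : ∀ (x y c : ℤ) → (x ℤ.- c) ℤ.- (y ℤ.- c) ≡ x ℤ.- y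
  difference≡ = ℤSolver.solve-∀

Is-n-progression : ∀ {b X c n₀ n} → Is-n b X c n₀ → (+ n) ≡ c [mod b ] → ¬ InE X n →
  ∃ λ j → n ≡ n₀ ℕ.+ j ℕ.* b
Is-n-progression {c = c} {n₀} {n} n₀-least@((n₀≡c , _) , _) n≡c n∉E
  with n₀≤n ← IsLeast-≤ n₀-least (λ ¬P → n∉E λ n∈P → ¬P (n≡c , n∈P))
  with ≡[mod]⇒∣∸ {c = c} n≡c n₀≡c n₀≤n
... | ℕD.divides j n∸n₀≡ =
  j , trans (sym (ℕP.m+[n∸m]≡n n₀≤n)) (cong (n₀ ℕ.+_) n∸n₀≡)

≡[mod]-reflect : ∀ {b a n} N → a ≤ b → n ≤ N ℕ.* b → (+ n) ≡ (+ a) [mod b ] →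
  (+ (N ℕ.* b ∸ n)) ≡ (+ (b ∸ a)) [mod b ]
≡[mod]-reflect {b} {a} {n} N a≤b n≤Nb n≡a =
  ℤD.∣⇒∣ᵤ (subst (ℤD._∣_ (+ b)) difference≡
    (ℤD.∣m∣n⇒∣m-n (ℤD.∣m∣n⇒∣m-n (ℤD.∣n⇒∣m*n (+ N) (ℤD.∣-refl {+ b})) (ℤD.∣-refl {+ b}))
      (ℤD.∣ᵤ⇒∣ {i = + n ℤ.- + a} n≡a)))
  where
  open ≡-Reasoning
  regroup : ∀ (N b n a : ℤ) →
    (N ℤ.* b ℤ.- b) ℤ.- (n ℤ.- a) ≡ (N ℤ.* b ℤ.- n) ℤ.- (b ℤ.- a)
  regroup = ℤSolver.solve-∀
  difference≡ : (+ N ℤ.* + b ℤ.- + b) ℤ.- (+ n ℤ.- + a) ≡ + (N ℕ.* b ∸ n) ℤ.- + (b ∸ a)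
  difference≡ = begin
    (+ N ℤ.* + b ℤ.- + b) ℤ.- (+ n ℤ.- + a) ≡⟨ regroup (+ N) (+ b) (+ n) (+ a) ⟩
    (+ N ℤ.* + b ℤ.- + n) ℤ.- (+ b ℤ.- + a) ≡⟨ cong (λ z → (z ℤ.- + n) ℤ.- (+ b ℤ.- + a))
                                                    (sym (ℤP.pos-* N b)) ⟩
    (+ (N ℕ.* b) ℤ.- + n) ℤ.- (+ b ℤ.- + a)   ≡⟨ cong₂ ℤ._-_ (pos-∸ n≤Nb) (pos-∸ a≤b) ⟩
    + (N ℕ.* b ∸ n) ℤ.- + (b ∸ a)             ∎

¬InReflect⇒ : ∀ {M Y n} → n ≤ M → ¬ InReflect M Y (+ n) → ¬ Y (M ∸ n)
¬InReflect⇒ {M} {Y} {n} n≤M n∉M-Y Y[M∸n] =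
  n∉M-Y (M ∸ n , Y[M∸n] ,
         sym (trans (pos-∸ (ℕP.m∸n≤m M n)) (cong +_ (ℕP.m∸[m∸n]≡n n≤M))))

pos-∸-< : ∀ {x y z} → y ≤ x → x < z ℕ.+ y → + x ℤ.- + y ℤ.< + z
pos-∸-< {x} {y} {z} y≤x x<z+y = subst (ℤ._< + z) (sym (pos-∸ y≤x))
  (ℤ.+<+ (subst (x ∸ y <_) (ℕP.m+n∸n≡m z y) (ℕP.∸-monoˡ-< x<z+y y≤x)))

pos-<-∸ : ∀ {x y z} → x ℕ.+ y < z → + x ℤ.< + z ℤ.- + y
pos-<-∸ {x} {y} {z} x+y<z = subst (+ x ℤ.<_) (sym (pos-∸ (ℕP.m+n≤o⇒n≤o (suc x) x+y<z)))
  (ℤ.+<+ (ℕP.m+n≤o⇒m≤o∸n (suc x) x+y<z))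

exceptional-bound : ∀ {N b} NB nA nB j k → 1 ≤ b →
  N ℕ.* b ≡ (nA ℕ.+ j ℕ.* b) ℕ.+ (nB ℕ.+ k ℕ.* b) → N < k ℕ.+ NB →
  + j ℤ.* + b ℤ.< + NB ℤ.* + b ℤ.- (+ nA ℤ.+ + nB)
exceptional-bound {N} {b} NB nA nB j k 1≤b Nb≡ N<k+NB =
  subst₂ ℤ._<_ (ℤP.pos-* j b) (cong₂ ℤ._-_ (ℤP.pos-* NB b) (ℤP.pos-+ nA nB))
    (pos-<-∸ (ℕP.<-≤-trans (ℕP.m<m+n (j ℕ.* b ℕ.+ (nA ℕ.+ nB)) 1≤b) bounded))
  where
  open ℕP.≤-Reasoning
  regroup : ∀ j b nA nB k → k ℕ.* b ℕ.+ (j ℕ.* b ℕ.+ (nA ℕ.+ nB) ℕ.+ b)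
                         ≡ b ℕ.+ ((nA ℕ.+ j ℕ.* b) ℕ.+ (nB ℕ.+ k ℕ.* b))
  regroup = ℕSolver.solve-∀
  bounded : j ℕ.* b ℕ.+ (nA ℕ.+ nB) ℕ.+ b ≤ NB ℕ.* b
  bounded = ℕP.+-cancelˡ-≤ (k ℕ.* b) _ _ (begin
    k ℕ.* b ℕ.+ (j ℕ.* b ℕ.+ (nA ℕ.+ nB) ℕ.+ b) ≡⟨ regroup j b nA nB k ⟩
    b ℕ.+ ((nA ℕ.+ j ℕ.* b) ℕ.+ (nB ℕ.+ k ℕ.* b)) ≡⟨ cong (b ℕ.+_) Nb≡ ⟨
    suc N ℕ.* b                                  ≤⟨ ℕP.*-monoˡ-≤ b N<k+NB ⟩
    (k ℕ.+ NB) ℕ.* b                             ≡⟨ ℕP.*-distribʳ-+ b k NB ⟩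
    k ℕ.* b ℕ.+ NB ℕ.* b                         ∎)

represented-or-large : ∀ {A b N NA NB nA nB n} j k →
  0 ∈ A → b ∈ A → All.All (_≤ b) A →
  InNA NA A nA → InNA NB (b minus A) nB → n ≤ N ℕ.* b →
  n ≡ nA ℕ.+ j ℕ.* b → N ℕ.* b ∸ n ≡ nB ℕ.+ k ℕ.* b →
  InNA N A n ⊎ (N < j ℕ.+ NA × N < k ℕ.+ NB)
represented-or-large {A} {b} {N} {NA} {NB} j k 0∈A b∈A A≤b nA∈NA·A nB∈NB·B
  n≤Nb n≡ Nb∸n≡
  with j ℕ.+ NA ℕP.≤? N | k ℕ.+ NB ℕP.≤? N
... | yes j+NA≤N | _ =
  inj₁ (subst (InNA N A) (sym n≡) (InNA-progression j 0∈A b∈A nA∈NA·A j+NA≤N))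
... | no _ | yes k+NB≤N =
  inj₁ (subst (InNA N A) (ℕP.m∸[m∸n]≡n n≤Nb) (InNA-minus A≤b
    (subst (InNA N (b minus A)) (sym Nb∸n≡)
      (InNA-progression k (0∈minus b∈A) (b∈minus 0∈A) nB∈NB·B k+NB≤N))))
... | no j+NA≰N | no k+NB≰N = inj₂ (ℕP.≰⇒> j+NA≰N , ℕP.≰⇒> k+NB≰N)

mainTheorem14 : (A : List ℕ) (b : ℕ) → IsBasis A b →
    (a : ℕ) → a < b →
    (nA nB NA NB : ℕ) →
    Is-n b A (+ a) nA → Is-N A nA NA →
    Is-n b (b minus A) (+ (b ℕ.∸ a)) nB → Is-N (b minus A) nB NB →
    (N : ℕ) → 1 ≤ N → NA ≤ N → NB ≤ N →
    (n : ℕ) → n ≤ N ℕ.* b → (+ n) ≡ (+ a) [mod b ] →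
    ¬ InE A n → ¬ InReflect (N ℕ.* b) (InE (b minus A)) (+ n) →
    InNA N A n
    ⊎ (∃ λ (j : ℤ) → (+ n) ≡ (+ nA) ℤ.+ j ℤ.* (+ b)
         × ((+ N) ℤ.- (+ NA)) ℤ.< j
         × j ℤ.* (+ b) ℤ.< (+ NB) ℤ.* (+ b) ℤ.- ((+ nA) ℤ.+ (+ nB)))
mainTheorem14 A b basis a a<b nA nB NA NB nA-least (nA∈NA·A , _) nB-least (nB∈NB·B , _)
  N _ NA≤N NB≤N n n≤Nb n≡a n∉E Nb∸n∉E =
  let j , n≡ = Is-n-progression {c = + a} nA-least n≡a n∉E
      k , Nb∸n≡ = Is-n-progression {c = + (b ∸ a)} nB-least
         (≡[mod]-reflect N (ℕP.<⇒≤ a<b) n≤Nb n≡a) (¬InReflect⇒ n≤Nb Nb∸n∉E)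
      Nb≡ = trans (sym (ℕP.m+[n∸m]≡n n≤Nb)) (cong₂ ℕ._+_ n≡ Nb∸n≡) in
  Sum.map₂ (λ (N<j+NA , N<k+NB) → + j , trans (cong +_ n≡) (pos-+* nA j b) ,
                                   pos-∸-< NA≤N N<j+NA ,
                                   exceptional-bound NB nA nB j k b≥1 Nb≡ N<k+NB)
           (represented-or-large j k zero∈A b∈A bounded nA∈NA·A nB∈NB·B n≤Nb n≡ Nb∸n≡)
  where open IsBasis basis
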